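{- Let $n\ge 6$ and $k\ge 4$ be integers, and let $G\in\mathcal{G}(n,k)$ be $3$-edge-balanced. Then $3(n+1)(n^2-n-4)$ divides $4k(k-1)(k-2)$. Moreover, the number of triangles in $G$ equals $\frac{4k(k-1)(k-2)}{3(n+1)(n^2-n-4)}$.
   Context: Graphs are taken on the fixed vertex set $[n]=\{1,\dots,n\}$, and $K_n$ is the complete graph on $[n]$. For an integer $j\ge 0$, $\mathcal{G}(n,j)$ denotes the set of all graphs on $[n]$ with exactly $j$ edges. For $G\in\mathcal{G}(n,k)$ and an integer $t$ with $0<t<k$, $G$ is called $t$-edge-balanced if there is a positive integer $\lambda$ such that every $H\in\mathcal{G}(n,t)$ is contained in exactly $\lambda$ graphs $G'\in\mathcal{G}(n,k)$ that are isomorphic to $G$ and satisfy $E(H)\subseteq E(G')$. A triangle in $G$ is a subgraph of $G$ isomorphic to $K_3$. -}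

module Defs where

open import Data.Nat using (ℕ; _+_; _<ᵇ_)
open import Data.Bool using (Bool; true; false; _∧_; if_then_else_)
open import Data.Fin using (Fin; toℕ)
open import Data.Vec using (Vec; lookup)
open import Data.List using (List; allFin; length; cartesianProduct; map)
open import Data.List.Relation.Unary.Unique.Propositional using (Unique)
open import Data.List.Membership.Propositional using (_∈_)
open import Data.Fin.Permutation using (Permutation′; _⟨$⟩ʳ_)
open import Data.Product using (Σ; _×_; _,_; ∃; ∃-syntax)
open import Relation.Binary.PropositionalEquality using (_≡_)
open import Function.Bundles using (_⇔_)

-- A graph on the vertex set Fin n (standing for [n]) is given by its
-- adjacency matrix, required to be symmetric and irreflexive.  This
-- representation is canonical: distinct graphs = distinct matrices.
AdjMat : ℕ → Set
AdjMat n = Vec (Vec Bool n) n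

adj : ∀ {n} → AdjMat n → Fin n → Fin n → Bool
adj A i j = lookup (lookup A i) j

IsGraph : ∀ {n} → AdjMat n → Set
IsGraph {n} A = (∀ (i j : Fin n) → adj A i j ≡ adj A j i) × (∀ (i : Fin n) → adj A i i ≡ false)

countᵇ : ∀ {A : Set} → (A → Bool) → List A → ℕ
countᵇ p Data.List.[] = 0
countᵇ p (x Data.List.∷ xs) = (if p x then 1 else 0) + countᵇ p xs

numEdges : ∀ {n} → AdjMat n → ℕ
numEdges {n} A = countᵇ (λ { (i , j) → (toℕ i <ᵇ toℕ j) ∧ adj A i j })
                        (cartesianProduct (allFin n) (allFin n))

InG : (n j : ℕ) → AdjMat n → Set
InG n j A = IsGraph A × numEdges A ≡ j

Isomorphic : ∀ {n} → AdjMat n → AdjMat n → Set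
Isomorphic {n} G G' = Σ (Permutation′ n) (λ σ → ∀ (i j : Fin n) → adj G i j ≡ adj G' (σ ⟨$⟩ʳ i) (σ ⟨$⟩ʳ j))

EdgeSubset : ∀ {n} → AdjMat n → AdjMat n → Set
EdgeSubset {n} H G' = ∀ (i j : Fin n) → adj H i j ≡ true → adj G' i j ≡ true

HasExactly : {A : Set} → ℕ → (A → Set) → Set
HasExactly {A} m P = ∃[ L ] (length L ≡ m × Unique L × (∀ (x : A) → (x ∈ L) ⇔ P x))

EdgeBalanced : (n k t : ℕ) → AdjMat n → Set
EdgeBalanced n k t G =
  ∃[ λ' ] (1 Data.Nat.≤ λ' ×
    (∀ (H : AdjMat n) → InG n t H →
       HasExactly λ' (λ G' → InG n k G' × Isomorphic G G' × EdgeSubset H G')))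

numTriangles : ∀ {n} → AdjMat n → ℕ
numTriangles {n} A =
  countᵇ (λ { (a , b , c) → (toℕ a <ᵇ toℕ b) ∧ (toℕ b <ᵇ toℕ c)
                             ∧ adj A a b ∧ adj A b c ∧ adj A a c })
         (cartesianProduct (allFin n) (cartesianProduct (allFin n) (allFin n)))

-- Let λ' be the balance constant and S the set of copies of G (graphs on [n]
-- isomorphic to G).  Counting the pairs (H, G′) with G′ ∈ S and E(H) ⊆ E(G′),
-- once over all C(C(n,2),3) graphs H with three edges and once over the C(n,3)
-- triangles H, gives
--   C(C(n,2),3) · λ' = |S| · C(k,3)   and   C(n,3) · λ' = |S| · t,
-- where t is the number of triangles of G, the same in every copy of G.  Hence
-- t · C(C(n,2),3) = C(n,3) · C(k,3), and 48 · C(C(n,2),3) = n(n−1)(n−2)(n+1)(n²−n−4)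
-- turns this into 3(n+1)(n²−n−4) · t = 4k(k−1)(k−2).

module Submission where

open import Defs
open import Data.Bool using (Bool; true; false; T; _∧_; _∨_; if_then_else_)
import Data.Bool as Bool
open import Data.Bool.ListAction using (all)
open import Data.Bool.Properties using (T-≡; T-∧; T-∨; ∧-assoc; ∧-identityʳ; ∧-zeroʳ; ∨-comm)
open import Data.Empty using (⊥-elim)
open import Data.Fin using (Fin; toℕ) renaming (zero to fzero; suc to fsuc)
open import Data.Fin.Permutation using (Permutation′; _⟨$⟩ʳ_)
open import Data.Fin.Properties using (all?; toℕ-injective) renaming (_≟_ to _≟ᶠ_)
open import Data.List
  using (List; []; _∷_; _++_; map; length; lookup; tabulate; allFin; cartesianProduct; filterᵇ; concatMap; deduplicate)
import Data.List.Membership.DecPropositional as DecMembership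
open import Data.List.Membership.Propositional using (_∈_; find; lose)
open import Data.List.Membership.Propositional.Properties
  using (∈-lookup; ∈-allFin; ∈-cartesianProduct⁺; ∈-map⁻; ∈-++⁻; ∈-++⁺ˡ; ∈-++⁺ʳ; ∈-filter⁺; ∈-filter⁻;
         ∈-concatMap⁺; ∈-concatMap⁻; ∈-deduplicate⁺; ∈-deduplicate⁻)
open import Data.List.Membership.Propositional.Properties.WithK using (unique∧set⇒bag)
open import Data.List.Properties using (length-++; length-map)
open import Data.List.Relation.Binary.BagAndSetEquality using (∼bag⇒↭)
open import Data.List.Relation.Binary.Permutation.Propositional.Properties using (↭-length)
open import Data.List.Relation.Binary.Sublist.Propositional using (_⊆_; []; _∷_; _∷ʳ_; minimum)
open import Data.List.Relation.Binary.Sublist.Propositional.Properties using (All-resp-⊆)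
open import Data.List.Relation.Unary.All using (All; []; _∷_)
import Data.List.Relation.Unary.All as All
open import Data.List.Relation.Unary.All.Properties using (all⁺; all⁻; all-filter)
open import Data.List.Relation.Unary.AllPairs using ([]; _∷_)
open import Data.List.Relation.Unary.Any using (here)
open import Data.List.Relation.Unary.Unique.DecPropositional.Properties using (deduplicate-!)
open import Data.List.Relation.Unary.Unique.Propositional using (Unique)
open import Data.List.Relation.Unary.Unique.Propositional.Properties using (allFin⁺; cartesianProduct⁺; filter⁺)
open import Data.Nat using (ℕ; zero; suc; _+_; _*_; _∸_; _≤_; _<_; _<ᵇ_; s≤s; z≤n)
import Data.Nat as ℕ
open import Data.Nat.Combinatorics using (_C_; nC1≡n; nCk+nC[k+1]≡[n+1]C[k+1])
open import Data.Nat.Divisibility using (_∣_; divides)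
open import Data.Nat.Properties
  using (+-0-commutativeMonoid; +-assoc; +-identityʳ; +-cancelʳ-≡; *-assoc; *-comm; *-identityˡ; *-identityʳ;
         *-zeroʳ; *-distribʳ-+; *-cancelˡ-≡; ≤-trans; <-trans; <-asym; <-irrefl; <-cmp; <⇒≢; <ᵇ⇒<; <⇒<ᵇ; m+n∸n≡m)
open import Data.Nat.Tactic.RingSolver using (solve-∀)
open import Algebra.Properties.CommutativeMonoid.Sum +-0-commutativeMonoid
  using (sum-syntax; sum-cong-≗; ∑-comm; ∑-distrib-+; ∑-permute)
open import Data.Product using (_×_; _,_; proj₁; proj₂; uncurry)
open import Data.Product.Properties using (≡-dec)
open import Data.Sum using (_⊎_; inj₁; inj₂; reduce)
import Data.Sum as Sum
open import Data.Unit using (tt)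
import Data.Vec as Vec
open import Data.Vec.Properties using (lookup∘tabulate) renaming (≡-dec to ≡-decᵛ)
open import Function using (_∘_; _⇔_; mk⇔; Equivalence)
open import Function.Construct.Identity using (⇔-id)
open import Relation.Binary.Definitions using (tri<; tri≈; tri>)
open import Relation.Binary.PropositionalEquality
open import Relation.Nullary using (¬_; Dec; yes; no; isYes)
open import Relation.Nullary.Decidable using (T?; _×-dec_; toWitness; fromWitness)

-- Counting

𝟙 : Bool → ℕ
𝟙 b = if b then 1 else 0

𝟙-∧ : ∀ x y → 𝟙 (x ∧ y) ≡ 𝟙 x * 𝟙 y
𝟙-∧ true  y = sym (+-identityʳ (𝟙 y))
𝟙-∧ false y = refl

∑-const : ∀ n c → ∑[ i < n ] c ≡ n * c
∑-const zero    c = refl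
∑-const (suc n) c = cong (c +_) (∑-const n c)

module _ {A : Set} where

  countᵇ-cong : ∀ {p q : A → Bool} (xs : List A) → (∀ x → p x ≡ q x) → countᵇ p xs ≡ countᵇ q xs
  countᵇ-cong []       p≗q = refl
  countᵇ-cong (x ∷ xs) p≗q = cong₂ (λ b m → 𝟙 b + m) (p≗q x) (countᵇ-cong xs p≗q)

  countᵇ-false : (xs : List A) → countᵇ (λ _ → false) xs ≡ 0
  countᵇ-false []       = refl
  countᵇ-false (x ∷ xs) = countᵇ-false xs

  countᵇ-++ : ∀ p (xs ys : List A) → countᵇ p (xs ++ ys) ≡ countᵇ p xs + countᵇ p ys
  countᵇ-++ p []       ys = refl
  countᵇ-++ p (x ∷ xs) ys = trans (cong (𝟙 (p x) +_) (countᵇ-++ p xs ys)) (sym (+-assoc (𝟙 (p x)) _ _))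

  countᵇ-map : ∀ {B : Set} p (f : B → A) xs → countᵇ p (map f xs) ≡ countᵇ (p ∘ f) xs
  countᵇ-map p f []       = refl
  countᵇ-map p f (x ∷ xs) = cong (𝟙 (p (f x)) +_) (countᵇ-map p f xs)

  countᵇ-filterᵇ : ∀ p q (xs : List A) → countᵇ q (filterᵇ p xs) ≡ countᵇ (λ x → p x ∧ q x) xs
  countᵇ-filterᵇ p q []       = refl
  countᵇ-filterᵇ p q (x ∷ xs) with p x
  ... | true  = cong (𝟙 (q x) +_) (countᵇ-filterᵇ p q xs)
  ... | false = countᵇ-filterᵇ p q xs

  length-filterᵇ : ∀ p (xs : List A) → length (filterᵇ p xs) ≡ countᵇ p xs
  length-filterᵇ p []       = refl
  length-filterᵇ p (x ∷ xs) with p x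
  ... | true  = cong suc (length-filterᵇ p xs)
  ... | false = length-filterᵇ p xs

  countᵇ-lookup : ∀ p (xs : List A) → countᵇ p xs ≡ ∑[ i < length xs ] 𝟙 (p (lookup xs i))
  countᵇ-lookup p []       = refl
  countᵇ-lookup p (x ∷ xs) = cong (𝟙 (p x) +_) (countᵇ-lookup p xs)

  countᵇ-tabulate : ∀ {n} p (f : Fin n → A) → countᵇ p (tabulate f) ≡ ∑[ i < n ] 𝟙 (p (f i))
  countᵇ-tabulate {zero}  p f = refl
  countᵇ-tabulate {suc n} p f = cong (𝟙 (p (f fzero)) +_) (countᵇ-tabulate p (f ∘ fsuc))

  Unique⇒HasExactly : ∀ {xs : List A} → Unique xs → HasExactly (length xs) (_∈ xs)
  Unique⇒HasExactly {xs} xs! = xs , refl , xs! , λ _ → ⇔-id _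

  countᵇ-HasExactly : ∀ {m} {P : A → Set} p (xs : List A) → Unique xs →
    (∀ {x} → P x → x ∈ xs) → (∀ {x} → x ∈ xs → T (p x) ⇔ P x) →
    HasExactly m P → countᵇ p xs ≡ m
  countᵇ-HasExactly p xs xs! P⊆xs p⇔P (ws , |ws|≡m , ws! , ∈ws⇔P) = begin
    countᵇ p xs              ≡⟨ length-filterᵇ p xs ⟨
    length (filterᵇ p xs)    ≡⟨ ↭-length (∼bag⇒↭ (unique∧set⇒bag (filter⁺ (T? ∘ p) xs!) ws! same)) ⟩
    length ws                ≡⟨ |ws|≡m ⟩
    _                        ∎
    where
    open ≡-Reasoning
    same : ∀ {x} → x ∈ filterᵇ p xs ⇔ x ∈ ws
    same {x} = mk⇔
      (λ x∈ → let x∈xs , px = ∈-filter⁻ (T? ∘ p) x∈ in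
              Equivalence.from (∈ws⇔P x) (Equivalence.to (p⇔P x∈xs) px))
      (λ x∈ws → let Px = Equivalence.to (∈ws⇔P x) x∈ws in
                ∈-filter⁺ (T? ∘ p) (P⊆xs Px) (Equivalence.from (p⇔P (P⊆xs Px)) Px))

countᵇ-cartesianProduct : ∀ {A B : Set} {n} (p : A × B → Bool) (f : Fin n → A) (ys : List B) →
  countᵇ p (cartesianProduct (tabulate f) ys) ≡ ∑[ i < n ] countᵇ (λ y → p (f i , y)) ys
countᵇ-cartesianProduct {n = zero}  p f ys = refl
countᵇ-cartesianProduct {n = suc n} p f ys = begin
  countᵇ p (map (f fzero ,_) ys ++ cartesianProduct (tabulate (f ∘ fsuc)) ys)
    ≡⟨ countᵇ-++ p (map (f fzero ,_) ys) _ ⟩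
  countᵇ p (map (f fzero ,_) ys) + countᵇ p (cartesianProduct (tabulate (f ∘ fsuc)) ys)
    ≡⟨ cong₂ _+_ (countᵇ-map p (f fzero ,_) ys) (countᵇ-cartesianProduct p (f ∘ fsuc) ys) ⟩
  countᵇ (λ y → p (f fzero , y)) ys + ∑[ i < n ] countᵇ (λ y → p (f (fsuc i) , y)) ys
    ∎
  where open ≡-Reasoning

double-counting : ∀ {A B : Set} (r : A → B → Bool) (xs : List A) (ys : List B) {d e : ℕ} →
  (∀ {x} → x ∈ xs → countᵇ (r x) ys ≡ d) → (∀ {y} → y ∈ ys → countᵇ (λ x → r x y) xs ≡ e) →
  length xs * d ≡ length ys * e
double-counting r xs ys {d} {e} row col = begin
  length xs * d                                     ≡⟨ ∑-const (length xs) d ⟨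
  ∑[ i < length xs ] d                              ≡⟨ sum-cong-≗ (λ i → sym (row (∈-lookup i))) ⟩
  ∑[ i < length xs ] countᵇ (r (x i)) ys            ≡⟨ sum-cong-≗ (λ i → countᵇ-lookup (r (x i)) ys) ⟩
  ∑[ i < length xs ] ∑[ j < length ys ] 𝟙 (r (x i) (y j))
                                                    ≡⟨ ∑-comm (λ i j → 𝟙 (r (x i) (y j))) ⟩
  ∑[ j < length ys ] ∑[ i < length xs ] 𝟙 (r (x i) (y j))
                                                    ≡⟨ sum-cong-≗ (λ j → countᵇ-lookup (λ x′ → r x′ (y j)) xs) ⟨
  ∑[ j < length ys ] countᵇ (λ x′ → r x′ (y j)) xs  ≡⟨ sum-cong-≗ (λ j → col (∈-lookup j)) ⟩
  ∑[ j < length ys ] e                              ≡⟨ ∑-const (length ys) e ⟩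
  length ys * e                                     ∎
  where
  open ≡-Reasoning
  x = lookup xs
  y = lookup ys

module _ {A : Set} where

  Unique-resp-⊇ : ∀ {xs ys : List A} → xs ⊆ ys → Unique ys → Unique xs
  Unique-resp-⊇ []         []          = []
  Unique-resp-⊇ (_ ∷ʳ τ)   (_ ∷ ys!)   = Unique-resp-⊇ τ ys!
  Unique-resp-⊇ (refl ∷ τ) (y∉ ∷ ys!)  = All-resp-⊆ τ y∉ ∷ Unique-resp-⊇ τ ys!

  combinations : ℕ → List A → List (List A)
  combinations zero    xs       = [] ∷ []
  combinations (suc k) []       = []
  combinations (suc k) (x ∷ xs) = map (x ∷_) (combinations k xs) ++ combinations (suc k) xs

  length-combinations : ∀ k (xs : List A) → length (combinations k xs) ≡ length xs C k
  length-combinations zero    xs       = refl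
  length-combinations (suc k) []       = refl
  length-combinations (suc k) (x ∷ xs) = begin
    length (map (x ∷_) (combinations k xs) ++ combinations (suc k) xs)
      ≡⟨ length-++ (map (x ∷_) (combinations k xs)) ⟩
    length (map (x ∷_) (combinations k xs)) + length (combinations (suc k) xs)
      ≡⟨ cong₂ _+_ (trans (length-map {B = List A} (x ∷_) (combinations k xs)) (length-combinations k xs))
                   (length-combinations (suc k) xs) ⟩
    length xs C k + length xs C suc k
      ≡⟨ nCk+nC[k+1]≡[n+1]C[k+1] (length xs) k ⟩
    suc (length xs) C suc k
      ∎
    where open ≡-Reasoning

  countᵇ-all-combinations : ∀ p k (xs : List A) → countᵇ (all p) (combinations k xs) ≡ countᵇ p xs C k
  countᵇ-all-combinations p zero    xs       = refl
  countᵇ-all-combinations p (suc k) []       = refl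
  countᵇ-all-combinations p (suc k) (x ∷ xs)
    rewrite countᵇ-++ (all p) (map (x ∷_) (combinations k xs)) (combinations (suc k) xs)
          | countᵇ-map (all p) (x ∷_) (combinations k xs)
    with p x
  ... | true  = trans (cong₂ _+_ (countᵇ-all-combinations p k xs) (countᵇ-all-combinations p (suc k) xs))
                      (nCk+nC[k+1]≡[n+1]C[k+1] (countᵇ p xs) k)
  ... | false = cong₂ _+_ (countᵇ-false (combinations k xs)) (countᵇ-all-combinations p (suc k) xs)

  ∈-combinations⁻ : ∀ k (xs : List A) {s} → s ∈ combinations k xs → s ⊆ xs × length s ≡ k
  ∈-combinations⁻ zero    xs       (here refl) = minimum xs , refl
  ∈-combinations⁻ (suc k) (x ∷ xs) s∈ with ∈-++⁻ (map (x ∷_) (combinations k xs)) s∈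
  ... | inj₂ s∈′ = let τ , |s| = ∈-combinations⁻ (suc k) xs s∈′ in x ∷ʳ τ , |s|
  ... | inj₁ s∈′ with ∈-map⁻ (x ∷_) s∈′
  ...   | t , t∈ , refl = let τ , |t| = ∈-combinations⁻ k xs t∈ in refl ∷ τ , cong suc |t|

-- Sums over pairs and triples of vertices

_≺_ : ∀ {n} → Fin n → Fin n → Bool
i ≺ j = toℕ i <ᵇ toℕ j

module _ {n : ℕ} where

  ≺⇒< : ∀ (i j : Fin n) → (i ≺ j) ≡ true → toℕ i < toℕ j
  ≺⇒< i j i≺j = <ᵇ⇒< (toℕ i) (toℕ j) (Equivalence.from T-≡ i≺j)

  <⇒≺ : ∀ (i j : Fin n) → toℕ i < toℕ j → (i ≺ j) ≡ true
  <⇒≺ i j i<j = Equivalence.to T-≡ (<⇒<ᵇ i<j)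

  ≮⇒⊀ : ∀ (i j : Fin n) → ¬ toℕ i < toℕ j → (i ≺ j) ≡ false
  ≮⇒⊀ i j i≮j with i ≺ j in i≺j
  ... | true  = ⊥-elim (i≮j (≺⇒< i j i≺j))
  ... | false = refl

  𝟙≺-total : ∀ {i j : Fin n} → i ≢ j → 𝟙 (i ≺ j) + 𝟙 (j ≺ i) ≡ 1
  𝟙≺-total {i} {j} i≢j with <-cmp (toℕ i) (toℕ j)
  ... | tri< i<j _ j≮i rewrite <⇒≺ i j i<j | ≮⇒⊀ j i j≮i = refl
  ... | tri≈ _ i≡j _   = ⊥-elim (i≢j (toℕ-injective i≡j))
  ... | tri> i≮j _ j<i rewrite ≮⇒⊀ i j i≮j | <⇒≺ j i j<i = refl

  ≺-trans : ∀ (a b c : Fin n) → (a ≺ b) ≡ true → (b ≺ c) ≡ true → (a ≺ c) ≡ true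
  ≺-trans a b c a≺b b≺c = <⇒≺ a c (<-trans (≺⇒< a b a≺b) (≺⇒< b c b≺c))

  𝟙≺-trans : ∀ (a b c : Fin n) → 𝟙 (a ≺ b) * (𝟙 (b ≺ c) * 𝟙 (a ≺ c)) ≡ 𝟙 (a ≺ b) * 𝟙 (b ≺ c)
  𝟙≺-trans a b c with a ≺ b in a≺b | b ≺ c in b≺c | a ≺ c in a≺c
  ... | true  | true  | true  = refl
  ... | true  | true  | false with () ← trans (sym a≺c) (≺-trans a b c a≺b b≺c)
  ... | true  | false | _     = refl
  ... | false | _     | _     = refl

∑-zero : ∀ n → ∑[ i < n ] 0 ≡ 0
∑-zero n = trans (∑-const n 0) (*-zeroʳ n)

∑²-increasing : ∀ n → ∑[ i < n ] ∑[ j < n ] 𝟙 (i ≺ j) ≡ n C 2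
∑²-increasing zero    = refl
∑²-increasing (suc n) = begin
  ∑[ j < n ] 1 + ∑[ i < n ] ∑[ j < n ] 𝟙 (i ≺ j)   ≡⟨ cong₂ _+_ (trans (∑-const n 1) (*-identityʳ n)) (∑²-increasing n) ⟩
  n + n C 2                                        ≡⟨ cong (_+ n C 2) (nC1≡n n) ⟨
  n C 1 + n C 2                                    ≡⟨ nCk+nC[k+1]≡[n+1]C[k+1] n 1 ⟩
  suc n C 2                                        ∎
  where open ≡-Reasoning

∑³ : ∀ {n} → (Fin n → Fin n → Fin n → ℕ) → ℕ
∑³ {n} f = ∑[ a < n ] ∑[ b < n ] ∑[ c < n ] f a b c

∑³-increasing : ∀ n → ∑³ (λ (a b c : Fin n) → 𝟙 (a ≺ b ∧ b ≺ c)) ≡ n C 3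
∑³-increasing zero    = refl
∑³-increasing (suc n) = begin
  -- the terms in which a, b or c is 0 are written out
    (∑[ c < suc n ] 0 + ∑[ b < n ] ∑[ c < n ] 𝟙 (b ≺ c))
  + ∑[ a < n ] (∑[ c < suc n ] 0 + ∑[ b < n ] (𝟙 (a ≺ b ∧ false) + ∑[ c < n ] 𝟙 (a ≺ b ∧ b ≺ c)))
      ≡⟨ cong₂ _+_ (cong₂ _+_ (∑-zero (suc n)) (∑²-increasing n))
                   (sum-cong-≗ λ a → cong₂ _+_ (∑-zero (suc n))
                     (sum-cong-≗ λ b → cong (λ x → 𝟙 x + ∑[ c < n ] 𝟙 (a ≺ b ∧ b ≺ c)) (∧-zeroʳ (a ≺ b)))) ⟩
  n C 2 + ∑³ (λ (a b c : Fin n) → 𝟙 (a ≺ b ∧ b ≺ c))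
      ≡⟨ cong (n C 2 +_) (∑³-increasing n) ⟩
  n C 2 + n C 3
      ≡⟨ nCk+nC[k+1]≡[n+1]C[k+1] n 2 ⟩
  suc n C 3
      ∎
  where open ≡-Reasoning

module _ {n : ℕ} where

  ∑³-cong : ∀ {f g : Fin n → Fin n → Fin n → ℕ} → (∀ a b c → f a b c ≡ g a b c) → ∑³ f ≡ ∑³ g
  ∑³-cong f≗g = sum-cong-≗ λ a → sum-cong-≗ λ b → sum-cong-≗ λ c → f≗g a b c

  ∑³-distrib-+ : ∀ (f g : Fin n → Fin n → Fin n → ℕ) →
    ∑³ (λ a b c → f a b c + g a b c) ≡ ∑³ f + ∑³ g
  ∑³-distrib-+ f g = trans
    (sum-cong-≗ λ a → trans (sum-cong-≗ λ b → ∑-distrib-+ (f a b) (g a b))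
                            (∑-distrib-+ (λ b → ∑[ c < n ] f a b c) (λ b → ∑[ c < n ] g a b c)))
    (∑-distrib-+ (λ a → ∑[ b < n ] ∑[ c < n ] f a b c) (λ a → ∑[ b < n ] ∑[ c < n ] g a b c))

  ∑³-swap₁₂ : ∀ (f : Fin n → Fin n → Fin n → ℕ) → ∑³ f ≡ ∑³ (λ a b c → f b a c)
  ∑³-swap₁₂ f = ∑-comm (λ a b → ∑[ c < n ] f a b c)

  ∑³-swap₂₃ : ∀ (f : Fin n → Fin n → Fin n → ℕ) → ∑³ f ≡ ∑³ (λ a b c → f a c b)
  ∑³-swap₂₃ f = sum-cong-≗ λ a → ∑-comm (f a)

  ∑³-rotate : ∀ (f : Fin n → Fin n → Fin n → ℕ) → ∑³ f ≡ ∑³ (λ a b c → f b c a)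
  ∑³-rotate f = trans (∑³-swap₂₃ f) (∑³-swap₁₂ (λ a b c → f a c b))

  ∑³-permute : ∀ (f : Fin n → Fin n → Fin n → ℕ) (σ : Permutation′ n) →
    ∑³ f ≡ ∑³ (λ a b c → f (σ ⟨$⟩ʳ a) (σ ⟨$⟩ʳ b) (σ ⟨$⟩ʳ c))
  ∑³-permute f σ = begin
    ∑³ f
      ≡⟨ sum-cong-≗ (λ a → sum-cong-≗ λ b → ∑-permute (f a b) σ) ⟩
    ∑³ (λ a b c → f a b (σ ⟨$⟩ʳ c))
      ≡⟨ sum-cong-≗ (λ a → ∑-permute (λ b → ∑[ c < n ] f a b (σ ⟨$⟩ʳ c)) σ) ⟩
    ∑³ (λ a b c → f a (σ ⟨$⟩ʳ b) (σ ⟨$⟩ʳ c))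
      ≡⟨ ∑-permute (λ a → ∑[ b < n ] ∑[ c < n ] f a (σ ⟨$⟩ʳ b) (σ ⟨$⟩ʳ c)) σ ⟩
    ∑³ (λ a b c → f (σ ⟨$⟩ʳ a) (σ ⟨$⟩ʳ b) (σ ⟨$⟩ʳ c))
      ∎
    where open ≡-Reasoning

  𝟙≺-split : ∀ (i j : Fin n) m → (i ≡ j → m ≡ 0) → m ≡ 𝟙 (i ≺ j) * m + 𝟙 (j ≺ i) * m
  𝟙≺-split i j m diag with i ≟ᶠ j
  ... | yes refl rewrite diag refl = sym (cong₂ _+_ (*-zeroʳ (𝟙 (i ≺ i))) (*-zeroʳ (𝟙 (i ≺ i))))
  ... | no i≢j = begin
    m                                 ≡⟨ *-identityˡ m ⟨
    1 * m                             ≡⟨ cong (_* m) (𝟙≺-total i≢j) ⟨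
    (𝟙 (i ≺ j) + 𝟙 (j ≺ i)) * m       ≡⟨ *-distribʳ-+ m (𝟙 (i ≺ j)) (𝟙 (j ≺ i)) ⟩
    𝟙 (i ≺ j) * m + 𝟙 (j ≺ i) * m     ∎
    where open ≡-Reasoning

-- Each term splits by the relative order of a, b and c, and by the symmetry of f
-- the six orders contribute equally.
module _ {n : ℕ} (f : Fin n → Fin n → Fin n → ℕ)
         (f-swap₁₂ : ∀ a b c → f a b c ≡ f b a c)
         (f-swap₂₃ : ∀ a b c → f a b c ≡ f a c b)
         (f-diagonal : ∀ a c → f a a c ≡ 0) where

  private
    a<b a>b a<b<c a<c<b c<a<b : Fin n → Fin n → Fin n → ℕ
    a<b   a b c = 𝟙 (a ≺ b) * f a b c
    a>b   a b c = 𝟙 (b ≺ a) * f a b c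
    a<b<c a b c = 𝟙 (a ≺ b) * (𝟙 (b ≺ c) * f a b c)
    a<c<b a b c = 𝟙 (a ≺ b) * (𝟙 (c ≺ b) * (𝟙 (a ≺ c) * f a b c))
    c<a<b a b c = 𝟙 (a ≺ b) * (𝟙 (c ≺ b) * (𝟙 (c ≺ a) * f a b c))

    W : ℕ
    W = ∑³ a<b<c

    collapse : ∀ a b c F → F ≡ f a b c → 𝟙 (a ≺ b) * (𝟙 (b ≺ c) * 𝟙 (a ≺ c)) * F ≡ a<b<c a b c
    collapse a b c F refl = trans (cong (_* F) (𝟙≺-trans a b c)) (*-assoc (𝟙 (a ≺ b)) (𝟙 (b ≺ c)) F)

    by-order-of-a-b : ∑³ f ≡ ∑³ a<b + ∑³ a<b
    by-order-of-a-b = begin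
      ∑³ f               ≡⟨ ∑³-cong (λ a b c → 𝟙≺-split a b (f a b c) λ { refl → f-diagonal a c }) ⟩
      ∑³ (λ a b c → a<b a b c + a>b a b c)
                         ≡⟨ ∑³-distrib-+ a<b a>b ⟩
      ∑³ a<b + ∑³ a>b    ≡⟨ cong (∑³ a<b +_) (trans (∑³-swap₁₂ a>b) (∑³-cong a>b≡)) ⟩
      ∑³ a<b + ∑³ a<b    ∎
      where
      open ≡-Reasoning
      a>b≡ : ∀ a b c → a>b b a c ≡ a<b a b c
      a>b≡ a b c = cong (𝟙 (a ≺ b) *_) (sym (f-swap₁₂ a b c))

    expand : ∀ a b c → a<b a b c ≡ a<b<c a b c + (a<c<b a b c + c<a<b a b c)
    expand a b c = begin
      x * F
        ≡⟨ cong (x *_) (𝟙≺-split b c F λ { refl → f-b≡c }) ⟩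
      x * (y * F + z * F)
        ≡⟨ cong (λ m → x * (y * F + z * m)) (𝟙≺-split a c F λ { refl → f-a≡c }) ⟩
      x * (y * F + z * (w * F + u * F))
        ≡⟨ distribute x y z w u F ⟩
      x * (y * F) + (x * (z * (w * F)) + x * (z * (u * F)))
        ∎
      where
      open ≡-Reasoning
      F = f a b c
      x = 𝟙 (a ≺ b); y = 𝟙 (b ≺ c); z = 𝟙 (c ≺ b); w = 𝟙 (a ≺ c); u = 𝟙 (c ≺ a)
      f-b≡c : f a b b ≡ 0
      f-b≡c = trans (f-swap₁₂ a b b) (trans (f-swap₂₃ b a b) (f-diagonal b a))
      f-a≡c : f a b a ≡ 0
      f-a≡c = trans (f-swap₂₃ a b a) (f-diagonal a b)
      distribute : ∀ x y z w u F → x * (y * F + z * (w * F + u * F))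
                                 ≡ x * (y * F) + (x * (z * (w * F)) + x * (z * (u * F)))
      distribute = solve-∀

    by-position-of-c : ∑³ a<b ≡ W + (W + W)
    by-position-of-c = begin
      ∑³ a<b                             ≡⟨ ∑³-cong expand ⟩
      ∑³ (λ a b c → a<b<c a b c + (a<c<b a b c + c<a<b a b c))
                                         ≡⟨ ∑³-distrib-+ a<b<c (λ a b c → a<c<b a b c + c<a<b a b c) ⟩
      W + ∑³ (λ a b c → a<c<b a b c + c<a<b a b c)
                                         ≡⟨ cong (W +_) (∑³-distrib-+ a<c<b c<a<b) ⟩
      W + (∑³ a<c<b + ∑³ c<a<b)          ≡⟨ cong (W +_) (cong₂ _+_ (trans (∑³-swap₂₃ a<c<b) (∑³-cong a<c<b≡))
                                                                   (trans (∑³-rotate c<a<b) (∑³-cong c<a<b≡))) ⟩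
      W + (W + W)                        ∎
      where
      open ≡-Reasoning
      a<c<b≡ : ∀ a b c → a<c<b a c b ≡ a<b<c a b c
      a<c<b≡ a b c = trans (reorder (𝟙 (a ≺ b)) (𝟙 (b ≺ c)) (𝟙 (a ≺ c)) (f a c b))
                           (collapse a b c _ (sym (f-swap₂₃ a b c)))
        where reorder : ∀ x y z F → z * (y * (x * F)) ≡ x * (y * z) * F
              reorder = solve-∀
      c<a<b≡ : ∀ a b c → c<a<b b c a ≡ a<b<c a b c
      c<a<b≡ a b c = trans (reorder (𝟙 (a ≺ b)) (𝟙 (b ≺ c)) (𝟙 (a ≺ c)) (f b c a))
                           (collapse a b c _ (sym (trans (f-swap₁₂ a b c) (f-swap₂₃ b a c))))
        where reorder : ∀ x y z F → y * (z * (x * F)) ≡ x * (y * z) * F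
              reorder = solve-∀

  ∑³-symmetric : ∑³ f ≡ 6 * ∑³ (λ a b c → 𝟙 (a ≺ b) * (𝟙 (b ≺ c) * f a b c))
  ∑³-symmetric = begin
    ∑³ f                             ≡⟨ by-order-of-a-b ⟩
    ∑³ a<b + ∑³ a<b                  ≡⟨ cong₂ _+_ by-position-of-c by-position-of-c ⟩
    (W + (W + W)) + (W + (W + W))    ≡⟨ six W ⟩
    6 * W                            ∎
    where
    open ≡-Reasoning
    six : ∀ W → (W + (W + W)) + (W + (W + W)) ≡ 6 * W
    six = solve-∀

-- Graphs given by lists of edges

Edge : ℕ → Set
Edge n = Fin n × Fin n

module _ {n : ℕ} where

  open DecMembership (≡-dec (_≟ᶠ_ {n}) (_≟ᶠ_ {n})) using (_∈?_)

  vertexPairs : List (Edge n)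
  vertexPairs = cartesianProduct (allFin n) (allFin n)

  vertexTriples : List (Fin n × Fin n × Fin n)
  vertexTriples = cartesianProduct (allFin n) vertexPairs

  countᵇ-vertexPairs : ∀ p → countᵇ p vertexPairs ≡ ∑[ i < n ] ∑[ j < n ] 𝟙 (p (i , j))
  countᵇ-vertexPairs p = trans (countᵇ-cartesianProduct p (λ i → i) (allFin n))
                               (sum-cong-≗ λ i → countᵇ-tabulate (λ j → p (i , j)) (λ j → j))

  countᵇ-vertexTriples : ∀ p → countᵇ p vertexTriples ≡ ∑³ (λ a b c → 𝟙 (p (a , b , c)))
  countᵇ-vertexTriples p = trans (countᵇ-cartesianProduct p (λ a → a) vertexPairs)
                                 (sum-cong-≗ λ a → countᵇ-vertexPairs (λ e → p (a , e)))

  vertexPairs-complete : ∀ e → e ∈ vertexPairs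
  vertexPairs-complete (i , j) = ∈-cartesianProduct⁺ (∈-allFin i) (∈-allFin j)

  increasing : Edge n → Bool
  increasing (i , j) = i ≺ j

  graphOf : List (Edge n) → AdjMat n
  graphOf es = Vec.tabulate λ i → Vec.tabulate λ j → isYes ((i , j) ∈? es) ∨ isYes ((j , i) ∈? es)

  adj-graphOf : ∀ es i j → adj (graphOf es) i j ≡ isYes ((i , j) ∈? es) ∨ isYes ((j , i) ∈? es)
  adj-graphOf es i j = trans (cong (λ row → Vec.lookup row j) (lookup∘tabulate _ i)) (lookup∘tabulate _ j)

  T-adj-graphOf : ∀ es i j → T (adj (graphOf es) i j) ⇔ ((i , j) ∈ es ⊎ (j , i) ∈ es)
  T-adj-graphOf es i j rewrite adj-graphOf es i j = mk⇔
    (Sum.map (toWitness {a? = ij?}) (toWitness {a? = ji?}) ∘ Equivalence.to T-∨)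
    (Equivalence.from T-∨ ∘ Sum.map (fromWitness {a? = ij?}) (fromWitness {a? = ji?}))
    where ij? = (i , j) ∈? es
          ji? = (j , i) ∈? es

  graphOf-IsGraph : ∀ {es} → All (T ∘ increasing) es → IsGraph (graphOf es)
  graphOf-IsGraph {es} inc = symmetric , irreflexive
    where
    symmetric : ∀ i j → adj (graphOf es) i j ≡ adj (graphOf es) j i
    symmetric i j rewrite adj-graphOf es i j | adj-graphOf es j i =
      ∨-comm (isYes ((i , j) ∈? es)) (isYes ((j , i) ∈? es))
    irreflexive : ∀ i → adj (graphOf es) i i ≡ false
    irreflexive i with adj (graphOf es) i i in ii
    ... | false = refl
    ... | true  = ⊥-elim (<-irrefl refl (<ᵇ⇒< (toℕ i) (toℕ i) (All.lookup inc loop)))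
      where
      loop : (i , i) ∈ es
      loop = reduce (Equivalence.to (T-adj-graphOf es i i) (subst T (sym ii) tt))

  numEdges-graphOf : ∀ {es} → Unique es → All (T ∘ increasing) es → numEdges (graphOf es) ≡ length es
  numEdges-graphOf {es} es! inc =
    countᵇ-HasExactly _ vertexPairs (cartesianProduct⁺ (allFin⁺ n) (allFin⁺ n)) (λ {e} _ → vertexPairs-complete e)
                      (λ { {i , j} _ → edge⇔ i j }) (Unique⇒HasExactly es!)
    where
    edge⇔ : ∀ i j → T (i ≺ j ∧ adj (graphOf es) i j) ⇔ (i , j) ∈ es
    edge⇔ i j = mk⇔ to from
      where
      to : T (i ≺ j ∧ adj (graphOf es) i j) → (i , j) ∈ es
      to t with Equivalence.to T-∧ t
      ... | i≺j , ij with Equivalence.to (T-adj-graphOf es i j) ij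
      ...   | inj₁ ij∈ = ij∈
      ...   | inj₂ ji∈ = ⊥-elim (<-asym (<ᵇ⇒< (toℕ i) (toℕ j) i≺j) (<ᵇ⇒< (toℕ j) (toℕ i) (All.lookup inc ji∈)))
      from : (i , j) ∈ es → T (i ≺ j ∧ adj (graphOf es) i j)
      from ij∈ = Equivalence.from T-∧ (All.lookup inc ij∈ , Equivalence.from (T-adj-graphOf es i j) (inj₁ ij∈))

  graphOf-InG : ∀ {es} → Unique es → All (T ∘ increasing) es → InG n (length es) (graphOf es)
  graphOf-InG es! inc = graphOf-IsGraph inc , numEdges-graphOf es! inc

  containsᵇ : AdjMat n → List (Edge n) → Bool
  containsᵇ A = all (uncurry (adj A))

  EdgeSubset-graphOf : ∀ A es → IsGraph A → EdgeSubset (graphOf es) A ⇔ T (containsᵇ A es)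
  EdgeSubset-graphOf A es (A-sym , _) = mk⇔ subset⇒contains contains⇒subset
    where
    subset⇒contains : EdgeSubset (graphOf es) A → T (containsᵇ A es)
    subset⇒contains sub = all⁻ (uncurry (adj A)) (All.tabulate λ { {i , j} ij∈ →
      Equivalence.from T-≡ (sub i j (Equivalence.to T-≡ (Equivalence.from (T-adj-graphOf es i j) (inj₁ ij∈)))) })
    edge : ∀ {i j} → All (T ∘ uncurry (adj A)) es → (i , j) ∈ es ⊎ (j , i) ∈ es → T (adj A i j)
    edge es⊆A (inj₁ ij∈)         = All.lookup es⊆A ij∈
    edge {i} {j} es⊆A (inj₂ ji∈) = subst T (A-sym j i) (All.lookup es⊆A ji∈)
    contains⇒subset : T (containsᵇ A es) → EdgeSubset (graphOf es) A
    contains⇒subset t i j ij = Equivalence.to T-≡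
      (edge (all⁺ (uncurry (adj A)) es t) (Equivalence.to (T-adj-graphOf es i j) (Equivalence.from T-≡ ij)))

  edges : List (Edge n)
  edges = filterᵇ increasing vertexPairs

  length-edges : length edges ≡ n C 2
  length-edges = trans (length-filterᵇ increasing vertexPairs) (trans (countᵇ-vertexPairs increasing) (∑²-increasing n))

  countᵇ-edges : ∀ A → countᵇ (uncurry (adj A)) edges ≡ numEdges A
  countᵇ-edges A = countᵇ-filterᵇ increasing (uncurry (adj A)) vertexPairs

  threeEdgeSets : List (List (Edge n))
  threeEdgeSets = combinations 3 edges

  length-threeEdgeSets : length threeEdgeSets ≡ (n C 2) C 3
  length-threeEdgeSets = trans (length-combinations 3 edges) (cong (_C 3) length-edges)

  threeEdgeSet-InG : ∀ {es} → es ∈ threeEdgeSets → InG n 3 (graphOf es)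
  threeEdgeSet-InG {es} es∈ with ∈-combinations⁻ 3 edges es∈
  ... | es⊆edges , |es|≡3 = subst (λ m → InG n m (graphOf es)) |es|≡3
          (graphOf-InG (Unique-resp-⊇ es⊆edges edges-unique) (All-resp-⊆ es⊆edges edges-increasing))
    where
    edges-unique : Unique edges
    edges-unique = filter⁺ (T? ∘ increasing) (cartesianProduct⁺ (allFin⁺ n) (allFin⁺ n))
    edges-increasing : All (T ∘ increasing) edges
    edges-increasing = all-filter (T? ∘ increasing) vertexPairs

  countᵇ-threeEdgeSets : ∀ {k} A → InG n k A → countᵇ (containsᵇ A) threeEdgeSets ≡ k C 3
  countᵇ-threeEdgeSets A (_ , |A|≡k) =
    trans (countᵇ-all-combinations (uncurry (adj A)) 3 edges) (cong (_C 3) (trans (countᵇ-edges A) |A|≡k))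

  triangle : Fin n × Fin n × Fin n → List (Edge n)
  triangle (a , b , c) = (a , b) ∷ (b , c) ∷ (a , c) ∷ []

  increasing₃ : Fin n × Fin n × Fin n → Bool
  increasing₃ (a , b , c) = a ≺ b ∧ b ≺ c

  triangles : List (List (Edge n))
  triangles = map triangle (filterᵇ increasing₃ vertexTriples)

  length-triangles : length triangles ≡ n C 3
  length-triangles = begin
    length triangles                                  ≡⟨ length-map triangle (filterᵇ increasing₃ vertexTriples) ⟩
    length (filterᵇ increasing₃ vertexTriples)        ≡⟨ length-filterᵇ increasing₃ vertexTriples ⟩
    countᵇ increasing₃ vertexTriples                  ≡⟨ countᵇ-vertexTriples increasing₃ ⟩
    ∑³ (λ (a b c : Fin n) → 𝟙 (a ≺ b ∧ b ≺ c))       ≡⟨ ∑³-increasing n ⟩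
    n C 3                                             ∎
    where open ≡-Reasoning

  triangle-InG : ∀ {es} → es ∈ triangles → InG n 3 (graphOf es)
  triangle-InG es∈ with ∈-map⁻ triangle es∈
  ... | (a , b , c) , abc∈ , refl
    with Equivalence.to (T-∧ {a ≺ b} {b ≺ c}) (proj₂ (∈-filter⁻ (T? ∘ increasing₃) {xs = vertexTriples} abc∈))
  ...   | a≺b , b≺c = graphOf-InG unique (a≺b ∷ b≺c ∷ a≺c ∷ [])
    where
    a<b = <ᵇ⇒< (toℕ a) (toℕ b) a≺b
    b<c = <ᵇ⇒< (toℕ b) (toℕ c) b≺c
    a≺c = <⇒<ᵇ (<-trans a<b b<c)
    a≢b : a ≢ b
    a≢b = <⇒≢ a<b ∘ cong toℕ
    b≢c : b ≢ c
    b≢c = <⇒≢ b<c ∘ cong toℕ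
    unique : Unique (triangle (a , b , c))
    unique = (a≢b ∘ cong proj₁ ∷ b≢c ∘ cong proj₂ ∷ []) ∷ (a≢b ∘ sym ∘ cong proj₁ ∷ []) ∷ [] ∷ []

  countᵇ-triangles : ∀ A → countᵇ (containsᵇ A) triangles ≡ numTriangles A
  countᵇ-triangles A = begin
    countᵇ (containsᵇ A) triangles
      ≡⟨ countᵇ-map (containsᵇ A) triangle (filterᵇ increasing₃ vertexTriples) ⟩
    countᵇ (containsᵇ A ∘ triangle) (filterᵇ increasing₃ vertexTriples)
      ≡⟨ countᵇ-filterᵇ increasing₃ (containsᵇ A ∘ triangle) vertexTriples ⟩
    countᵇ (λ t → increasing₃ t ∧ containsᵇ A (triangle t)) vertexTriples
      ≡⟨ countᵇ-cong vertexTriples (λ { (a , b , c) → reassociate (a ≺ b) (b ≺ c) (adj A a b) (adj A b c) (adj A a c) }) ⟩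
    numTriangles A
      ∎
    where
    open ≡-Reasoning
    reassociate : ∀ w x y z u → (w ∧ x) ∧ (y ∧ (z ∧ (u ∧ true))) ≡ w ∧ (x ∧ (y ∧ (z ∧ u)))
    reassociate w x y z u rewrite ∧-identityʳ u = ∧-assoc w x (y ∧ (z ∧ u))

  triangleWeight : AdjMat n → Fin n → Fin n → Fin n → ℕ
  triangleWeight A a b c = 𝟙 (adj A a b) * (𝟙 (adj A b c) * 𝟙 (adj A a c))

  numTriangles≡∑³ : ∀ A → numTriangles A ≡ ∑³ (λ a b c → 𝟙 (a ≺ b) * (𝟙 (b ≺ c) * triangleWeight A a b c))
  numTriangles≡∑³ A = trans (countᵇ-vertexTriples _) (∑³-cong λ a b c →
    let ab = adj A a b; bc = adj A b c; ac = adj A a c in begin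
    𝟙 (a ≺ b ∧ b ≺ c ∧ ab ∧ bc ∧ ac)                  ≡⟨ 𝟙-∧ (a ≺ b) (b ≺ c ∧ ab ∧ bc ∧ ac) ⟩
    𝟙 (a ≺ b) * 𝟙 (b ≺ c ∧ ab ∧ bc ∧ ac)              ≡⟨ cong (𝟙 (a ≺ b) *_) (𝟙-∧ (b ≺ c) (ab ∧ bc ∧ ac)) ⟩
    𝟙 (a ≺ b) * (𝟙 (b ≺ c) * 𝟙 (ab ∧ bc ∧ ac))        ≡⟨ cong (λ m → 𝟙 (a ≺ b) * (𝟙 (b ≺ c) * m))
                                                            (trans (𝟙-∧ ab (bc ∧ ac)) (cong (𝟙 ab *_) (𝟙-∧ bc ac))) ⟩
    𝟙 (a ≺ b) * (𝟙 (b ≺ c) * triangleWeight A a b c)   ∎)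
    where open ≡-Reasoning

  ∑³-triangleWeight : ∀ A → IsGraph A → ∑³ (triangleWeight A) ≡ 6 * numTriangles A
  ∑³-triangleWeight A (A-sym , A-irrefl) =
    trans (∑³-symmetric (triangleWeight A) swap₁₂ swap₂₃ diagonal) (cong (6 *_) (sym (numTriangles≡∑³ A)))
    where
    𝟙-sym : ∀ i j → 𝟙 (adj A i j) ≡ 𝟙 (adj A j i)
    𝟙-sym i j = cong 𝟙 (A-sym i j)
    swap₁₂ : ∀ a b c → triangleWeight A a b c ≡ triangleWeight A b a c
    swap₁₂ a b c = cong₂ _*_ (𝟙-sym a b) (*-comm (𝟙 (adj A b c)) (𝟙 (adj A a c)))
    swap₂₃ : ∀ a b c → triangleWeight A a b c ≡ triangleWeight A a c b
    swap₂₃ a b c = trans (reverse (𝟙 (adj A a b)) (𝟙 (adj A b c)) (𝟙 (adj A a c)))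
                         (cong (λ m → 𝟙 (adj A a c) * (m * 𝟙 (adj A a b))) (𝟙-sym b c))
      where reverse : ∀ x y z → x * (y * z) ≡ z * (y * x)
            reverse = solve-∀
    diagonal : ∀ a c → triangleWeight A a a c ≡ 0
    diagonal a c rewrite A-irrefl a = refl

  numTriangles-≅ : ∀ A B → IsGraph A → IsGraph B → Isomorphic A B → numTriangles A ≡ numTriangles B
  numTriangles-≅ A B A-graph B-graph (σ , A≅B) = *-cancelˡ-≡ _ _ 6 (begin
    6 * numTriangles A                                            ≡⟨ ∑³-triangleWeight A A-graph ⟨
    ∑³ (triangleWeight A)                                         ≡⟨ ∑³-cong weight-≅ ⟩
    ∑³ (λ a b c → triangleWeight B (σ ⟨$⟩ʳ a) (σ ⟨$⟩ʳ b) (σ ⟨$⟩ʳ c)) ≡⟨ ∑³-permute (triangleWeight B) σ ⟨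
    ∑³ (triangleWeight B)                                         ≡⟨ ∑³-triangleWeight B B-graph ⟩
    6 * numTriangles B                                            ∎)
    where
    open ≡-Reasoning
    weight-≅ : ∀ a b c → triangleWeight A a b c ≡ triangleWeight B (σ ⟨$⟩ʳ a) (σ ⟨$⟩ʳ b) (σ ⟨$⟩ʳ c)
    weight-≅ a b c = cong₂ _*_ (cong 𝟙 (A≅B a b)) (cong₂ _*_ (cong 𝟙 (A≅B b c)) (cong 𝟙 (A≅B a c)))

-- Binomial coefficients

2*nC2+n≡n² : ∀ n → 2 * (n C 2) + n ≡ n * n
2*nC2+n≡n² zero    = refl
2*nC2+n≡n² (suc n) = begin
  2 * (suc n C 2) + suc n         ≡⟨ cong (λ m → 2 * m + suc n) (nCk+nC[k+1]≡[n+1]C[k+1] n 1) ⟨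
  2 * (n C 1 + n C 2) + suc n     ≡⟨ cong (λ m → 2 * (m + n C 2) + suc n) (nC1≡n n) ⟩
  2 * (n + n C 2) + suc n         ≡⟨ expand n (n C 2) ⟩
  (2 * (n C 2) + n) + 2 * n + 1   ≡⟨ cong (λ m → m + 2 * n + 1) (2*nC2+n≡n² n) ⟩
  n * n + 2 * n + 1               ≡⟨ square n ⟩
  suc n * suc n                   ∎
  where
  open ≡-Reasoning
  expand : ∀ n c → 2 * (n + c) + suc n ≡ (2 * c + n) + 2 * n + 1
  expand = solve-∀
  square : ∀ n → n * n + 2 * n + 1 ≡ suc n * suc n
  square = solve-∀

6*nC3+3n²≡n³+2n : ∀ n → 6 * (n C 3) + 3 * (n * n) ≡ n * n * n + 2 * n
6*nC3+3n²≡n³+2n zero    = refl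
6*nC3+3n²≡n³+2n (suc n) = begin
  6 * (suc n C 3) + 3 * (suc n * suc n)
    ≡⟨ cong (λ m → 6 * m + 3 * (suc n * suc n)) (nCk+nC[k+1]≡[n+1]C[k+1] n 2) ⟨
  6 * (n C 2 + n C 3) + 3 * (suc n * suc n)
    ≡⟨ expand n (n C 2) (n C 3) ⟩
  3 * (2 * (n C 2) + n) + (6 * (n C 3) + 3 * (n * n)) + 3 * n + 3
    ≡⟨ cong₂ (λ x y → 3 * x + y + 3 * n + 3) (2*nC2+n≡n² n) (6*nC3+3n²≡n³+2n n) ⟩
  3 * (n * n) + (n * n * n + 2 * n) + 3 * n + 3
    ≡⟨ cube n ⟩
  suc n * suc n * suc n + 2 * suc n
    ∎
  where
  open ≡-Reasoning
  expand : ∀ n c₂ c₃ → 6 * (c₂ + c₃) + 3 * (suc n * suc n)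
                     ≡ 3 * (2 * c₂ + n) + (6 * c₃ + 3 * (n * n)) + 3 * n + 3
  expand = solve-∀
  cube : ∀ n → 3 * (n * n) + (n * n * n + 2 * n) + 3 * n + 3 ≡ suc n * suc n * suc n + 2 * suc n
  cube = solve-∀

6*nC3 : ∀ n → 6 * (n C 3) ≡ n * (n ∸ 1) * (n ∸ 2)
6*nC3 0             = refl
6*nC3 1             = refl
6*nC3 (suc (suc n)) = +-cancelʳ-≡ (3 * (m * m)) _ _ (trans (6*nC3+3n²≡n³+2n m) (falling n))
  where
  m = 2 + n
  falling : ∀ n → (2 + n) * (2 + n) * (2 + n) + 2 * (2 + n)
                ≡ (2 + n) * (1 + n) * n + 3 * ((2 + n) * (2 + n))
  falling = solve-∀

proportional : ∀ {a l} b c s t → 0 < a → 0 < l → a * l ≡ s * b → c * l ≡ s * t → t * a ≡ c * b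
proportional {suc _} _ _ zero _ (s≤s z≤n) (s≤s z≤n) () _
proportional {a} {l} b c s@(suc _) t _ _ al≡sb cl≡st = *-cancelˡ-≡ (t * a) (c * b) s (begin
  s * (t * a)     ≡⟨ *-assoc s t a ⟨
  s * t * a       ≡⟨ cong (_* a) cl≡st ⟨
  c * l * a       ≡⟨ swap c l a ⟩
  c * (a * l)     ≡⟨ cong (c *_) al≡sb ⟩
  c * (s * b)     ≡⟨ swap′ c s b ⟩
  s * (c * b)     ∎)
  where
  open ≡-Reasoning
  swap : ∀ c l a → c * l * a ≡ c * (a * l)
  swap = solve-∀
  swap′ : ∀ c s b → c * (s * b) ≡ s * (c * b)
  swap′ = solve-∀

-- Z is n² − n − 4 for n = 3 + m, written so that it evaluates to a successor,
-- which [nC2]C3>0 uses.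
module _ (m : ℕ) where

  private
    n = 3 + m
    Z = 2 + m * (5 + m)

    n²≡Z+4+n : n * n ≡ Z + 4 + n
    n²≡Z+4+n = square m
      where square : ∀ m → (3 + m) * (3 + m) ≡ 2 + m * (5 + m) + 4 + (3 + m)
            square = solve-∀

  n²-n-4≡ : n * n ∸ n ∸ 4 ≡ Z
  n²-n-4≡ = begin
    n * n ∸ n ∸ 4       ≡⟨ cong (λ x → x ∸ n ∸ 4) n²≡Z+4+n ⟩
    Z + 4 + n ∸ n ∸ 4   ≡⟨ cong (_∸ 4) (m+n∸n≡m (Z + 4) n) ⟩
    Z + 4 ∸ 4           ≡⟨ m+n∸n≡m Z 4 ⟩
    Z                   ∎
    where open ≡-Reasoning

  48*[nC2]C3≡ : 48 * ((n C 2) C 3) ≡ n * (n ∸ 1) * (n ∸ 2) * (n + 1) * Z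
  48*[nC2]C3≡ = begin
    48 * Q                              ≡⟨ +-cancelʳ-≡ (6 * ((Z + 4) * (Z + 4))) _ _ (trans scaled (identity Z)) ⟩
    (Z + 4) * (Z + 2) * Z               ≡⟨ factor m ⟩
    n * (n ∸ 1) * (n ∸ 2) * (n + 1) * Z ∎
    where
    open ≡-Reasoning
    N = n C 2
    Q = N C 3
    2N≡Z+4 : 2 * N ≡ Z + 4
    2N≡Z+4 = +-cancelʳ-≡ n _ _ (trans (2*nC2+n≡n² n) n²≡Z+4+n)
    scaled : 48 * Q + 6 * ((Z + 4) * (Z + 4)) ≡ (Z + 4) * (Z + 4) * (Z + 4) + 8 * (Z + 4)
    scaled = subst (λ X → 48 * Q + 6 * (X * X) ≡ X * X * X + 8 * X) 2N≡Z+4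
      (trans (times8 Q N) (trans (cong (8 *_) (6*nC3+3n²≡n³+2n N)) (times8′ N)))
      where
      times8 : ∀ Q N → 48 * Q + 6 * ((2 * N) * (2 * N)) ≡ 8 * (6 * Q + 3 * (N * N))
      times8 = solve-∀
      times8′ : ∀ N → 8 * (N * N * N + 2 * N) ≡ (2 * N) * (2 * N) * (2 * N) + 8 * (2 * N)
      times8′ = solve-∀
    identity : ∀ Z → (Z + 4) * (Z + 4) * (Z + 4) + 8 * (Z + 4)
                   ≡ (Z + 4) * (Z + 2) * Z + 6 * ((Z + 4) * (Z + 4))
    identity = solve-∀
    factor : ∀ m → (2 + m * (5 + m) + 4) * (2 + m * (5 + m) + 2) * (2 + m * (5 + m))
                 ≡ (3 + m) * (2 + m) * (1 + m) * (3 + m + 1) * (2 + m * (5 + m))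
    factor = solve-∀

[nC2]C3>0 : ∀ {n} → 3 ≤ n → 0 < (n C 2) C 3
[nC2]C3>0 (s≤s (s≤s (s≤s {n = m} z≤n))) = positive (48*[nC2]C3≡ m)
  where
  positive : ∀ {q x} → 48 * q ≡ suc x → 0 < q
  positive {suc _} _ = s≤s z≤n

triangle-count-formula : ∀ {n} k t → 3 ≤ n → t * ((n C 2) C 3) ≡ (n C 3) * (k C 3) →
  t * (3 * (n + 1) * (n * n ∸ n ∸ 4)) ≡ 4 * k * (k ∸ 1) * (k ∸ 2)
triangle-count-formula {n} k t (s≤s (s≤s (s≤s {n = m} z≤n))) tQ≡PK = *-cancelˡ-≡ _ _ (12 * u) (begin
  12 * u * (t * (3 * (n + 1) * R))        ≡⟨ regroup u n R t ⟩
  36 * t * (u * (n + 1) * R)              ≡⟨ cong (λ x → 36 * t * (u * (n + 1) * x)) (n²-n-4≡ m) ⟩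
  36 * t * (u * (n + 1) * Z)              ≡⟨ cong (36 * t *_) (48*[nC2]C3≡ m) ⟨
  36 * t * (48 * Q)                       ≡⟨ regroup′ t Q ⟩
  36 * 48 * (t * Q)                       ≡⟨ cong (36 * 48 *_) tQ≡PK ⟩
  36 * 48 * ((n C 3) * (k C 3))           ≡⟨ regroup″ (n C 3) (k C 3) ⟩
  48 * (6 * (n C 3)) * (6 * (k C 3))      ≡⟨ cong₂ (λ x y → 48 * x * y) (6*nC3 n) (6*nC3 k) ⟩
  48 * u * v                              ≡⟨ regroup‴ u k (k ∸ 1) (k ∸ 2) ⟩
  12 * u * (4 * k * (k ∸ 1) * (k ∸ 2))    ∎)
  where
  open ≡-Reasoning
  u = n * (n ∸ 1) * (n ∸ 2)
  v = k * (k ∸ 1) * (k ∸ 2)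
  R = n * n ∸ n ∸ 4
  Z = 2 + m * (5 + m)
  Q = (n C 2) C 3
  regroup : ∀ u n R t → 12 * u * (t * (3 * (n + 1) * R)) ≡ 36 * t * (u * (n + 1) * R)
  regroup = solve-∀
  regroup′ : ∀ t Q → 36 * t * (48 * Q) ≡ 36 * 48 * (t * Q)
  regroup′ = solve-∀
  regroup″ : ∀ P K → 36 * 48 * (P * K) ≡ 48 * (6 * P) * (6 * K)
  regroup″ = solve-∀
  regroup‴ : ∀ u k a b → 48 * u * (k * a * b) ≡ 12 * u * (4 * k * a * b)
  regroup‴ = solve-∀

-- Double counting in a 3-edge-balanced graph

InG? : ∀ {n} j (A : AdjMat n) → Dec (InG n j A)
InG? j A = (all? (λ i → all? λ i′ → adj A i i′ Bool.≟ adj A i′ i) ×-dec all? (λ i → adj A i i Bool.≟ false))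
           ×-dec (numEdges A ℕ.≟ j)

_≟ᴬ_ : ∀ {n} (A B : AdjMat n) → Dec (A ≡ B)
_≟ᴬ_ = ≡-decᵛ (≡-decᵛ Bool._≟_)

module Balanced {n k λ' : ℕ} (G : AdjMat n) (G∈𝒢 : InG n k G)
  (balanced : ∀ H → InG n 3 H → HasExactly λ' (λ G' → InG n k G' × Isomorphic G G' × EdgeSubset H G')) where

  CopyContaining : AdjMat n → AdjMat n → Set
  CopyContaining H G' = InG n k G' × Isomorphic G G' × EdgeSubset H G'

  copiesContaining : AdjMat n → List (AdjMat n)
  copiesContaining H with InG? 3 H
  ... | yes H∈𝒢 = proj₁ (balanced H H∈𝒢)
  ... | no _    = []

  ∈-copiesContaining⇔ : ∀ {H G'} → InG n 3 H → G' ∈ copiesContaining H ⇔ CopyContaining H G'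
  ∈-copiesContaining⇔ {H} {G'} H∈𝒢 with InG? 3 H
  ... | yes H∈𝒢′ = proj₂ (proj₂ (proj₂ (balanced H H∈𝒢′))) G'
  ... | no H∉𝒢   = ⊥-elim (H∉𝒢 H∈𝒢)

  -- Every triangle is also the graph of an entry of threeEdgeSets; listing the
  -- triangles again spares proving this.
  testEdgeSets : List (List (Edge n))
  testEdgeSets = threeEdgeSets ++ triangles

  testEdgeSet-InG : ∀ {es} → es ∈ testEdgeSets → InG n 3 (graphOf es)
  testEdgeSet-InG {es} es∈ with ∈-++⁻ threeEdgeSets es∈
  ... | inj₁ es∈threeEdgeSets = threeEdgeSet-InG es∈threeEdgeSets
  ... | inj₂ es∈triangles     = triangle-InG es∈triangles

  -- S, collected from the witness lists of the balance condition instead of from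
  -- the permutations of [n]; it contains every copy containing a test graph.
  copies : List (AdjMat n)
  copies = deduplicate _≟ᴬ_ (concatMap (copiesContaining ∘ graphOf) testEdgeSets)

  copyContaining⇒∈copies : ∀ {es G'} → es ∈ testEdgeSets → CopyContaining (graphOf es) G' → G' ∈ copies
  copyContaining⇒∈copies es∈ copy = ∈-deduplicate⁺ _≟ᴬ_ (∈-concatMap⁺ (copiesContaining ∘ graphOf)
    (lose es∈ (Equivalence.from (∈-copiesContaining⇔ (testEdgeSet-InG es∈)) copy)))

  ∈copies⇒copy : ∀ {G'} → G' ∈ copies → InG n k G' × Isomorphic G G'
  ∈copies⇒copy G'∈ with find (∈-concatMap⁻ (copiesContaining ∘ graphOf) (∈-deduplicate⁻ _≟ᴬ_ _ G'∈))
  ... | es , es∈ , G'∈copiesContaining =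
    let G'∈𝒢 , G≅G' , _ = Equivalence.to (∈-copiesContaining⇔ (testEdgeSet-InG es∈)) G'∈copiesContaining
    in G'∈𝒢 , G≅G'

  countᵇ-copies-containing : ∀ {es} → es ∈ testEdgeSets → countᵇ (λ G' → containsᵇ G' es) copies ≡ λ'
  countᵇ-copies-containing {es} es∈ = countᵇ-HasExactly (λ G' → containsᵇ G' es) copies (deduplicate-! _≟ᴬ_ _)
    (copyContaining⇒∈copies es∈) contains⇔copyContaining (balanced (graphOf es) (testEdgeSet-InG es∈))
    where
    contains⇔copyContaining : ∀ {G'} → G' ∈ copies → T (containsᵇ G' es) ⇔ CopyContaining (graphOf es) G'
    contains⇔copyContaining {G'} G'∈ = let G'∈𝒢 , G≅G' = ∈copies⇒copy G'∈; G'-graph = proj₁ G'∈𝒢 in mk⇔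
      (λ t → G'∈𝒢 , G≅G' , Equivalence.from (EdgeSubset-graphOf G' es G'-graph) t)
      (λ (_ , _ , sub) → Equivalence.to (EdgeSubset-graphOf G' es G'-graph) sub)

  double-count-threeEdgeSets : ((n C 2) C 3) * λ' ≡ length copies * (k C 3)
  double-count-threeEdgeSets = subst (λ x → x * λ' ≡ length copies * (k C 3)) (length-threeEdgeSets {n})
    (double-counting (λ es G' → containsᵇ G' es) threeEdgeSets copies
      (countᵇ-copies-containing ∘ ∈-++⁺ˡ) (λ {G'} G'∈ → countᵇ-threeEdgeSets G' (proj₁ (∈copies⇒copy G'∈))))

  double-count-triangles : (n C 3) * λ' ≡ length copies * numTriangles G
  double-count-triangles = subst (λ x → x * λ' ≡ length copies * numTriangles G) (length-triangles {n})
    (double-counting (λ es G' → containsᵇ G' es) triangles copies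
      (countᵇ-copies-containing ∘ ∈-++⁺ʳ threeEdgeSets) triangles-in-copy)
    where
    triangles-in-copy : ∀ {G'} → G' ∈ copies → countᵇ (containsᵇ G') triangles ≡ numTriangles G
    triangles-in-copy {G'} G'∈ = let G'∈𝒢 , G≅G' = ∈copies⇒copy G'∈ in
      trans (countᵇ-triangles G') (sym (numTriangles-≅ G G' (proj₁ G∈𝒢) (proj₁ G'∈𝒢) G≅G'))

mainTheorem3 : (n k : ℕ) → 6 ≤ n → 4 ≤ k → (G : AdjMat n) → InG n k G →
    EdgeBalanced n k 3 G →
    (3 * (n + 1) * (n * n ∸ n ∸ 4) ∣ 4 * k * (k ∸ 1) * (k ∸ 2))
    × (numTriangles G * (3 * (n + 1) * (n * n ∸ n ∸ 4)) ≡ 4 * k * (k ∸ 1) * (k ∸ 2))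
mainTheorem3 n k 6≤n _ G G∈𝒢 (λ' , 1≤λ' , balanced) = divides (numTriangles G) (sym formula) , formula
  where
  open Balanced G G∈𝒢 balanced
  3≤n : 3 ≤ n
  3≤n = ≤-trans (s≤s (s≤s (s≤s z≤n))) 6≤n
  tQ≡PK : numTriangles G * ((n C 2) C 3) ≡ (n C 3) * (k C 3)
  tQ≡PK = proportional (k C 3) (n C 3) (length copies) (numTriangles G) ([nC2]C3>0 3≤n) 1≤λ'
            double-count-threeEdgeSets double-count-triangles
  formula : numTriangles G * (3 * (n + 1) * (n * n ∸ n ∸ 4)) ≡ 4 * k * (k ∸ 1) * (k ∸ 2)
  formula = triangle-count-formula k (numTriangles G) 3≤n tQ≡PK
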